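{- Suppose an optimal (deterministic) policy $\mathcal{A}^*$ for a PNOI instance probes a box $B_j$ at a node $m$ of its decision tree, and suppose that when $B_j$ is observed to take value $V$, $\mathcal{A}^*$ takes a backup box somewhere further down the tree. Then there is another optimal policy $\mathcal{A}'$ whose decision tree coincides with that of $\mathcal{A}^*$ except possibly on the subtree rooted at $m$, and in $\mathcal{A}'$ the subtree rooted at $m$ is a $\le_V$ tree whose $\le_V$ path ends by taking a backup box.
   Context: An instance of PNOI consists of $n$ boxes; box $i$ has cost $c_i\ge0$ and hidden value $v_i\ge0$ drawn independently from a known finitely supported distribution $F_i$. A policy at each step may open an unopened box $i$ (paying $c_i$, observing $v_i$), or stop and take the opened box with the highest revealed value, or stop and take an unopened box without inspection; payoff = value taken minus total cost, and optimal means maximal expected payoff. A deterministic policy is a decision tree: each internal node opens a box and branches on the revealed value; leaves take a box. A box is a backup if it is taken without inspection. For $V\ge0$, a $\le_V$ tree is a decision (sub)tree that makes the same decisions irrespective of the values of the probed boxes as long as all these values are at most $V$; the sequence of decisions made when all observed values are at most $V$ forms a path, the $\le_V$ path. -}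

module Defs where

open import Data.Nat using (ℕ; zero; suc)
open import Data.Fin using (Fin; zero; suc)
open import Data.Rational using (ℚ; 0ℚ; 1ℚ; _+_; _*_; _-_; _⊔_; _≤_; _<_)
open import Data.List using (List; []; _∷_)
open import Data.List.Membership.Propositional using (_∈_)
open import Data.Product using (Σ; ∃; _×_; _,_)
open import Data.Empty using (⊥)
open import Data.Unit using (⊤)
open import Relation.Binary.PropositionalEquality using (_≡_; _≢_)
open import Relation.Nullary using (¬_)
open import Function.Definitions using (Injective)

sumFin : (m : ℕ) → (Fin m → ℚ) → ℚ
sumFin zero    f = 0ℚ
sumFin (suc m) f = f zero + sumFin m (λ k → f (suc k))

record Dist : Set where
  field
    size      : ℕ
    val       : Fin size → ℚ
    prob      : Fin size → ℚ
    val-nonneg  : ∀ k → 0ℚ ≤ val k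
    val-distinct : Injective _≡_ _≡_ val
    prob-pos  : ∀ k → 0ℚ < prob k
    prob-sum  : sumFin size prob ≡ 1ℚ
open Dist public

mean : Dist → ℚ
mean F = sumFin (size F) (λ k → prob F k * val F k)

record Instance : Set where
  field
    n         : ℕ
    cost      : Fin n → ℚ
    dist      : Fin n → Dist
    cost-nonneg : ∀ i → 0ℚ ≤ cost i
open Instance public

-- Deterministic policies as decision trees.
--   takeMax   : stop and take the opened box with the highest revealed value
--   backup j  : stop and take (unopened) box j without inspection
--   probe i f : open box i, and continue with f k if its value is val (F_i) k
data Tree (I : Instance) : Set where
  takeMax : Tree I
  backup  : Fin (n I) → Tree I
  probe   : (i : Fin (n I)) → (Fin (size (dist I i)) → Tree I) → Tree I

-- Well-formedness relative to the list of boxes already opened: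
-- only unopened boxes are opened / taken as backup, and takeMax
-- is only allowed once some box has been opened.
data WF (I : Instance) : List (Fin (n I)) → Tree I → Set where
  wf-takeMax : ∀ {os} → os ≢ [] → WF I os takeMax
  wf-backup  : ∀ {os j} → ¬ (j ∈ os) → WF I os (backup j)
  wf-probe   : ∀ {os i f} → ¬ (i ∈ os) → (∀ k → WF I (i ∷ os) (f k)) →
               WF I os (probe i f)

Policy : (I : Instance) → Tree I → Set
Policy I T = WF I [] T

-- Expected payoff of the subtree, given the best value revealed so far
-- (costs paid inside the subtree are subtracted).
payoffFrom : (I : Instance) → Tree I → ℚ → ℚ
payoffFrom I takeMax     best = best
payoffFrom I (backup j)  best = mean (dist I j)
payoffFrom I (probe i f) best =
  sumFin (size (dist I i))
    (λ k → prob (dist I i) k * payoffFrom I (f k) (best ⊔ val (dist I i) k))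
  - cost I i

-- Expected payoff of a policy (all values are ≥ 0, and takeMax needs a
-- nonempty set of opened boxes, so starting with best = 0 is exact).
payoff : (I : Instance) → Tree I → ℚ
payoff I T = payoffFrom I T 0ℚ

Optimal : (I : Instance) → Tree I → Set
Optimal I T = Policy I T × (∀ T' → Policy I T' → payoff I T' ≤ payoff I T)

data Node {I : Instance} : Tree I → Set where
  root  : ∀ {T} → Node T
  child : ∀ {i f} (k : Fin (size (dist I i))) → Node (f k) → Node (probe i f)

subtreeAt : ∀ {I} (T : Tree I) → Node T → Tree I
subtreeAt T root = T
subtreeAt (probe i f) (child k m) = subtreeAt (f k) m

replaceAt : ∀ {I} (T : Tree I) → Node T → Tree I → Tree I
replaceAt T root S = S
replaceAt {I} (probe i f) (child k m) S = probe i g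
  where
  g : Fin (size (dist I i)) → Tree I
  g k' with Data.Fin._≟_ k' k
  ... | Relation.Nullary.yes _ = replaceAt (f k) m S
  ... | Relation.Nullary.no  _ = f k'

data HasBackup {I : Instance} : Tree I → Set where
  here  : ∀ {j} → HasBackup (backup j)
  there : ∀ {i f} (k : Fin (size (dist I i))) → HasBackup (f k) → HasBackup (probe i f)

Low : (I : Instance) (V : ℚ) (i : Fin (n I)) → Fin (size (dist I i)) → Set
Low I V i k = val (dist I i) k ≤ V

data SameLow {I : Instance} (V : ℚ) : Tree I → Tree I → Set where
  same-takeMax : SameLow V takeMax takeMax
  same-backup  : ∀ {j} → SameLow V (backup j) (backup j)
  same-probe   : ∀ {i f g} → (∀ k → Low I V i k → SameLow V (f k) (g k)) →
                 SameLow V (probe i f) (probe i g)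

data LeVTree {I : Instance} (V : ℚ) : Tree I → Set where
  lev-takeMax : LeVTree V takeMax
  lev-backup  : ∀ {j} → LeVTree V (backup j)
  lev-probe   : ∀ {i f} →
                (∀ k k' → Low I V i k → Low I V i k' → SameLow V (f k) (f k')) →
                (∀ k → Low I V i k → LeVTree V (f k)) →
                LeVTree V (probe i f)

-- The ≤_V path ends by taking a backup box: every leaf reached along a
-- history with all observed values ≤ V is a backup leaf.
data LeVPathEndsInBackup {I : Instance} (V : ℚ) : Tree I → Set where
  end-backup : ∀ {j} → LeVPathEndsInBackup V (backup j)
  end-probe  : ∀ {i f} → (∀ k → Low I V i k → LeVPathEndsInBackup V (f k)) →
               LeVPathEndsInBackup V (probe i f)

{-# OPTIONS --safe #-}
-- Two facts drive the proof: the payoff of a subtree is monotone in the best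
-- value revealed before it, and every subtree of an optimal tree is optimal
-- for its own history.  Follow the branch of m in which B_j reveals V down to
-- a backup leaf and rebuild it bottom-up: at a probe whose branch on the path
-- reaches best value w ≥ V, every outcome with value ≤ w is sent to the subtree
-- already rebuilt below, and the other outcomes are left alone.
module Submission where

open import Data.Empty using (⊥-elim)
open import Data.Fin using (Fin; zero; suc; _≟_)
open import Data.List using (List; []; _∷_)
open import Data.Nat using (zero; suc)
open import Data.Product using (Σ; _×_; _,_)
open import Data.Rational
  using (ℚ; 0ℚ; _*_; _⊔_; _≤_; _<_; -_; _≤?_; positive; nonNegative)
open import Data.Rational.Properties hiding (_≟_)
open import Relation.Binary.PropositionalEquality using (_≡_; refl; subst; sym)
open import Relation.Nullary using (yes; no)

open import Defs

sumFin-mono-≤ : ∀ m {a b : Fin m → ℚ} → (∀ k → a k ≤ b k) → sumFin m a ≤ sumFin m b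
sumFin-mono-≤ zero    a≤b = ≤-refl
sumFin-mono-≤ (suc m) a≤b = +-mono-≤ (a≤b zero) (sumFin-mono-≤ m (λ k → a≤b (suc k)))

sumFin-mono-< : ∀ m {a b : Fin m → ℚ} → (∀ k → a k ≤ b k) →
                (k : Fin m) → a k < b k → sumFin m a < sumFin m b
sumFin-mono-< (suc m) a≤b zero    ak<bk =
  +-mono-<-≤ ak<bk (sumFin-mono-≤ m (λ k → a≤b (suc k)))
sumFin-mono-< (suc m) a≤b (suc k) ak<bk =
  +-mono-≤-< (a≤b zero) (sumFin-mono-< m (λ k → a≤b (suc k)) k ak<bk)

module Restructuring (I : Instance) where

  Outcome : Fin (n I) → Set
  Outcome i = Fin (size (dist I i))

  value : (i : Fin (n I)) → Outcome i → ℚ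
  value i = val (dist I i)

  weight : (i : Fin (n I)) → Outcome i → ℚ
  weight i = prob (dist I i)

  pay : Tree I → ℚ → ℚ
  pay = payoffFrom I

  weight-mono-≤ : ∀ i (k : Outcome i) {a b} → a ≤ b → weight i k * a ≤ weight i k * b
  weight-mono-≤ i k = *-monoˡ-≤-nonNeg (weight i k) {{nonNegative (<⇒≤ (prob-pos (dist I i) k))}}

  weight-mono-< : ∀ i (k : Outcome i) {a b} → a < b → weight i k * a < weight i k * b
  weight-mono-< i k = *-monoʳ-<-pos (weight i k) {{positive (prob-pos (dist I i) k)}}

  probe-mono-≤ : ∀ i (f g : Outcome i → Tree I) x y →
                 (∀ k → pay (f k) (x ⊔ value i k) ≤ pay (g k) (y ⊔ value i k)) →
                 pay (probe i f) x ≤ pay (probe i g) y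
  probe-mono-≤ i f g x y children =
    +-monoˡ-≤ (- cost I i) (sumFin-mono-≤ _ (λ k → weight-mono-≤ i k (children k)))

  probe-mono-< : ∀ i (f g : Outcome i → Tree I) x y →
                 (∀ k → pay (f k) (x ⊔ value i k) ≤ pay (g k) (y ⊔ value i k)) →
                 (k : Outcome i) → pay (f k) (x ⊔ value i k) < pay (g k) (y ⊔ value i k) →
                 pay (probe i f) x < pay (probe i g) y
  probe-mono-< i f g x y children k child< =
    +-monoˡ-< (- cost I i)
      (sumFin-mono-< _ (λ k → weight-mono-≤ i k (children k)) k (weight-mono-< i k child<))

  pay-mono : ∀ T {x y} → x ≤ y → pay T x ≤ pay T y
  pay-mono takeMax     x≤y = x≤y
  pay-mono (backup j)  x≤y = ≤-refl
  pay-mono (probe i f) {x} {y} x≤y =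
    probe-mono-≤ i f f x y (λ k → pay-mono (f k) (⊔-monoˡ-≤ (value i k) x≤y))

  openedAt : (T : Tree I) → Node T → List (Fin (n I)) → List (Fin (n I))
  openedAt T           root        os = os
  openedAt (probe i f) (child k m) os = openedAt (f k) m (i ∷ os)

  bestAt : (T : Tree I) → Node T → ℚ → ℚ
  bestAt T           root        x = x
  bestAt (probe i f) (child k m) x = bestAt (f k) m (x ⊔ value i k)

  WF-subtreeAt : ∀ {os} T (m : Node T) → WF I os T → WF I (openedAt T m os) (subtreeAt T m)
  WF-subtreeAt T           root        wf                = wf
  WF-subtreeAt (probe i f) (child k m) (wf-probe _ wf-f) = WF-subtreeAt (f k) m (wf-f k)

  -- replaceAt builds these children with a function local to its where block;
  -- subtreeAt is the only way to refer to it.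
  replacedChild : ∀ {i} f (k : Outcome i) → Node (f k) → Tree I → Outcome i → Tree I
  replacedChild {i} f k m S k′ = subtreeAt (replaceAt (probe i f) (child k m) S) (child k′ root)

  WF-replaceAt : ∀ {os} T (m : Node T) S → WF I os T → WF I (openedAt T m os) S →
                 WF I os (replaceAt T m S)
  WF-replaceAt T           root        S wf         wf-S = wf-S
  WF-replaceAt (probe i f) (child k m) S (wf-probe i∉os wf-f) wf-S = wf-probe i∉os wf-children
    where
    wf-children : ∀ k′ → WF I (i ∷ _) (replacedChild f k m S k′)
    wf-children k′ with k′ ≟ k
    ... | yes refl = WF-replaceAt (f k) m S (wf-f k) wf-S
    ... | no _     = wf-f k′

  replaceAt-mono-≤ : ∀ T (m : Node T) S {x} →
                     pay (subtreeAt T m) (bestAt T m x) ≤ pay S (bestAt T m x) →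
                     pay T x ≤ pay (replaceAt T m S) x
  replaceAt-mono-≤ T           root        S sub≤S = sub≤S
  replaceAt-mono-≤ (probe i f) (child k m) S {x} sub≤S =
    probe-mono-≤ i f (replacedChild f k m S) x x children
    where
    children : ∀ k′ → pay (f k′) (x ⊔ value i k′) ≤ pay (replacedChild f k m S k′) (x ⊔ value i k′)
    children k′ with k′ ≟ k
    ... | yes refl = replaceAt-mono-≤ (f k) m S sub≤S
    ... | no _     = ≤-refl

  replaceAt-mono-< : ∀ T (m : Node T) S {x} →
                     pay (subtreeAt T m) (bestAt T m x) < pay S (bestAt T m x) →
                     pay T x < pay (replaceAt T m S) x
  replaceAt-mono-< T           root        S sub<S = sub<S
  replaceAt-mono-< (probe i f) (child k m) S {x} sub<S =
    probe-mono-< i f (replacedChild f k m S) x x children k children-at-k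
    where
    children : ∀ k′ → pay (f k′) (x ⊔ value i k′) ≤ pay (replacedChild f k m S k′) (x ⊔ value i k′)
    children k′ with k′ ≟ k
    ... | yes refl = replaceAt-mono-≤ (f k) m S (<⇒≤ sub<S)
    ... | no _     = ≤-refl
    children-at-k : pay (f k) (x ⊔ value i k) < pay (replacedChild f k m S k) (x ⊔ value i k)
    children-at-k with k ≟ k
    ... | yes refl = replaceAt-mono-< (f k) m S sub<S
    ... | no k≢k   = ⊥-elim (k≢k refl)

  LocallyOptimal : List (Fin (n I)) → ℚ → Tree I → Set
  LocallyOptimal os x T = ∀ T′ → WF I os T′ → pay T′ x ≤ pay T x

  LocallyOptimal-subtreeAt : ∀ {os x} T (m : Node T) → WF I os T → LocallyOptimal os x T →
                             LocallyOptimal (openedAt T m os) (bestAt T m x) (subtreeAt T m)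
  LocallyOptimal-subtreeAt T m wf opt T′ wf-T′ = ≮⇒≥ λ sub<T′ →
    <-irrefl refl (<-≤-trans (replaceAt-mono-< T m T′ sub<T′)
                             (opt (replaceAt T m T′) (WF-replaceAt T m T′ wf wf-T′)))

  Optimal-replaceAt : ∀ {T} → Optimal I T → (m : Node T) → ∀ S →
                      WF I (openedAt T m []) S →
                      pay (subtreeAt T m) (bestAt T m 0ℚ) ≤ pay S (bestAt T m 0ℚ) →
                      Optimal I (replaceAt T m S)
  Optimal-replaceAt {T} (wf , opt) m S wf-S sub≤S =
    WF-replaceAt T m S wf wf-S ,
    λ T′ wf-T′ → ≤-trans (opt T′ wf-T′) (replaceAt-mono-≤ T m S sub≤S)

  Dominates : ℚ → Tree I → Tree I → Set
  Dominates x T R = ∀ z → z ≤ x → pay T x ≤ pay R z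

  redirectUpTo : ∀ {i} → ℚ → Tree I → (Outcome i → Tree I) → Outcome i → Tree I
  redirectUpTo {i} w R g k with value i k ≤? w
  ... | yes _ = R
  ... | no _  = g k

  redirectUpTo-≤ : ∀ {i w R g} (k : Outcome i) → value i k ≤ w → redirectUpTo w R g k ≡ R
  redirectUpTo-≤ {i} {w} k k≤w with value i k ≤? w
  ... | yes _   = refl
  ... | no  k≰w = ⊥-elim (k≰w k≤w)

  WF-redirectUpTo : ∀ {os i g w R} → WF I os (probe i g) → WF I (i ∷ os) R →
                    WF I os (probe i (redirectUpTo w R g))
  WF-redirectUpTo {i = i} {w = w} (wf-probe i∉os wf-g) wf-R = wf-probe i∉os wf-children
    where
    wf-children : ∀ k → WF I (i ∷ _) (redirectUpTo w _ _ k)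
    wf-children k with value i k ≤? w
    ... | yes _ = wf-R
    ... | no _  = wf-g k

  -- A child g k with value ≤ w earns at most what it would from w, which is at
  -- most what B earns from w, since g k is valid in B's place.
  Dominates-redirectUpTo : ∀ {os i g x w B R} → x ≤ w → WF I os (probe i g) →
                           LocallyOptimal (i ∷ os) w B → Dominates w B R →
                           Dominates x (probe i g) (probe i (redirectUpTo w R g))
  Dominates-redirectUpTo {i = i} {g} {x} {w} {B} {R} x≤w (wf-probe _ wf-g) opt-B B≼R z z≤x =
    probe-mono-≤ i g (redirectUpTo w R g) x z children
    where
    children : ∀ k → pay (g k) (x ⊔ value i k) ≤ pay (redirectUpTo w R g k) (z ⊔ value i k)
    children k with value i k ≤? w
    ... | yes k≤w = begin
      pay (g k) (x ⊔ value i k) ≤⟨ pay-mono (g k) (⊔-lub x≤w k≤w) ⟩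
      pay (g k) w               ≤⟨ opt-B (g k) (wf-g k) ⟩
      pay B w                   ≤⟨ B≼R (z ⊔ value i k) (⊔-lub (≤-trans z≤x x≤w) k≤w) ⟩
      pay R (z ⊔ value i k)     ∎
      where open ≤-Reasoning
    ... | no k≰w = pay-mono (g k) (⊔-lub x≤k (p≤q⊔p z (value i k)))
      where
      x≤k : x ≤ z ⊔ value i k
      x≤k = ≤-trans (≤-trans x≤w (<⇒≤ (≰⇒> k≰w))) (p≤q⊔p z (value i k))

  SameLow-refl : ∀ {V} T → SameLow {I} V T T
  SameLow-refl takeMax     = same-takeMax
  SameLow-refl (backup j)  = same-backup
  SameLow-refl (probe i g) = same-probe (λ k _ → SameLow-refl (g k))

  LeVTree-probe : ∀ {V i f R} → (∀ k → Low I V i k → f k ≡ R) → LeVTree V R →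
                  LeVTree V (probe {I} i f)
  LeVTree-probe {V} {f = f} {R} low≡R lev-R = lev-probe same lev-low
    where
    same : ∀ k k′ → Low I V _ k → Low I V _ k′ → SameLow V (f k) (f k′)
    same k k′ low-k low-k′ rewrite low≡R k low-k | low≡R k′ low-k′ = SameLow-refl R
    lev-low : ∀ k → Low I V _ k → LeVTree V (f k)
    lev-low k low-k = subst (LeVTree V) (sym (low≡R k low-k)) lev-R

  LeVPathEndsInBackup-probe : ∀ {V i f R} → (∀ k → Low I V i k → f k ≡ R) →
                              LeVPathEndsInBackup V R → LeVPathEndsInBackup V (probe {I} i f)
  LeVPathEndsInBackup-probe {V} low≡R end-R =
    end-probe (λ k low-k → subst (LeVPathEndsInBackup V) (sym (low≡R k low-k)) end-R)

  module _ (V : ℚ) where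

    LowBackupReplacement : List (Fin (n I)) → ℚ → Tree I → Set
    LowBackupReplacement os x T =
      Σ (Tree I) λ R → WF I os R × LeVTree V R × LeVPathEndsInBackup V R × Dominates x T R

    mutual
      rebuild : ∀ {os x} T → WF I os T → LocallyOptimal os x T → HasBackup T → V ≤ x →
                LowBackupReplacement os x T
      rebuild (backup j)  wf _   here          _   =
        backup j , wf , lev-backup , end-backup , λ _ _ → ≤-refl
      rebuild (probe i g) wf opt (there k has) V≤x =
        rebuildProbe k wf opt has (≤-trans V≤x (p≤p⊔q _ _))

      rebuildProbe : ∀ {os x i g} (k : Outcome i) → WF I os (probe i g) →
                     LocallyOptimal os x (probe i g) → HasBackup (g k) → V ≤ x ⊔ value i k →
                     LowBackupReplacement os x (probe i g)
      rebuildProbe {x = x} {i} {g} k wf opt has V≤w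
        with rebuild (g k) (WF-subtreeAt _ (child k root) wf)
                     (LocallyOptimal-subtreeAt _ (child k root) wf opt) has V≤w
      ... | R , wf-R , lev-R , end-R , gk≼R =
        probe i (redirectUpTo w R g) ,
        WF-redirectUpTo wf wf-R ,
        LeVTree-probe low≡R lev-R ,
        LeVPathEndsInBackup-probe low≡R end-R ,
        Dominates-redirectUpTo {B = g k} (p≤p⊔q x (value i k)) wf
          (LocallyOptimal-subtreeAt _ (child k root) wf opt) gk≼R
        where
        w = x ⊔ value i k
        low≡R : ∀ k′ → Low I V i k′ → redirectUpTo w R g k′ ≡ R
        low≡R k′ low = redirectUpTo-≤ k′ (≤-trans low V≤w)

lemma12 : (I : Instance) (A* : Tree I) → Optimal I A* →
          (m : Node A*) (j : Fin (n I)) (f : Fin (size (dist I j)) → Tree I) →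
          subtreeAt A* m ≡ probe j f →
          (V : ℚ) (k : Fin (size (dist I j))) → val (dist I j) k ≡ V →
          HasBackup (f k) →
          Σ (Tree I) (λ S → Optimal I (replaceAt A* m S) × LeVTree V S × LeVPathEndsInBackup V S)
lemma12 I A* opt-A*@(wf-A* , best-A*) m j f A*m≡probe .(val (dist I j) k) k refl has =
  let S , wf-S , lev-S , end-S , probe≼S =
        rebuildProbe (value j k) k wf-m opt-m has (p≤q⊔p x (value j k))
  in S , Optimal-replaceAt opt-A* m S wf-S
           (subst (λ T → pay T x ≤ pay S x) (sym A*m≡probe) (probe≼S x ≤-refl)) ,
     lev-S , end-S
  where
  open Restructuring I
  x : ℚ
  x = bestAt A* m 0ℚ
  wf-m : WF I (openedAt A* m []) (probe j f)
  wf-m = subst (WF I _) A*m≡probe (WF-subtreeAt A* m wf-A*)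
  opt-m : LocallyOptimal (openedAt A* m []) x (probe j f)
  opt-m = subst (LocallyOptimal _ x) A*m≡probe (LocallyOptimal-subtreeAt A* m wf-A* best-A*)
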